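{- Let $n_1,n_2$ be integers with $0\le n_1\le n_2$ and let $i\in\mathbb N$. Then $$\sigma^{ns}_i(\mathfrak G_{n_1,n_2})=\Big(1+\frac{n_1(1-i)}{(n_2+1)i}\Big)\binom{i+n_1-1}{n_1}\binom{i+n_2-1}{n_2}.$$
   Context: For integers $0\le n_1\le n_2$, $\mathfrak G_{n_1,n_2}$ is the digraph with vertices $v_1,\dots,v_{n_2},u_1,\dots,u_{n_1}$ and arcs $(v_j,v_{j+1})$ for $1\le j<n_2$, $(u_j,u_{j+1})$ for $1\le j<n_1$, and $(v_j,u_j)$ for $1\le j\le n_1$. For $i\in\mathbb N$, a non-strict disposition of size $i$ of a digraph $(V,A)$ is a map $f:V\to\{1,\dots,i\}$ such that $f(w_1)\ge f(w_2)$ whenever $(w_1,w_2)\in A$; $\sigma^{ns}_i$ denotes the number of such maps. -}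

module Defs where

open import Data.Nat using (ℕ; zero; suc; _+_; _*_; _≤_; NonZero)
open import Data.Fin using (Fin; zero; suc; inject₁; inject≤; _↑ˡ_; _↑ʳ_)
open import Data.Fin.Properties using (_≤?_)
import Data.Fin as Fin
import Data.Vec.Functional as VF
open import Data.List using (List; []; _∷_; map; concatMap; allFin; filter; length; _++_)
open import Data.List.Relation.Unary.All using (All; all?)
open import Data.Product using (_×_; _,_; proj₁; proj₂)

record Digraph : Set where
  constructor digraph
  field
    N    : ℕ
    arcs : List (Fin N × Fin N)
open Digraph public

-- Values {1,…,i} are represented by Fin i (order-isomorphic via k ↦ k+1).
-- A non-strict disposition of size i: f(w₁) ≥ f(w₂) for every arc (w₁,w₂).
IsNonStrictDisposition : (G : Digraph) (i : ℕ) → (Fin (N G) → Fin i) → Set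
IsNonStrictDisposition G i f = All (λ a → f (proj₂ a) Fin.≤ f (proj₁ a)) (arcs G)

allFuns : (n i : ℕ) → List (Fin n → Fin i)
allFuns zero    i = (λ ()) ∷ []
allFuns (suc n) i = concatMap (λ a → map (λ f → a VF.∷ f) (allFuns n i)) (allFin i)

σns : (i : ℕ) (G : Digraph) → ℕ
σns i G = length (filter (λ f → all? (λ a → f (proj₂ a) ≤? f (proj₁ a)) (arcs G)) (allFuns (N G) i))

pathArcs : (n : ℕ) → List (Fin n × Fin n)
pathArcs zero    = []
pathArcs (suc m) = map (λ j → (inject₁ j , suc j)) (allFin m)

-- 𝔊_{n₁,n₂}: vertices v_j ↦ (j-1) ↑ˡ n₁ (first n₂ indices), u_j ↦ n₂ ↑ʳ (j-1).
𝔊 : (n₁ n₂ : ℕ) → n₁ ≤ n₂ → Digraph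
𝔊 n₁ n₂ le = digraph (n₂ + n₁)
  ( map (λ a → (proj₁ a ↑ˡ n₁ , proj₂ a ↑ˡ n₁)) (pathArcs n₂)
  ++ map (λ a → (n₂ ↑ʳ proj₁ a , n₂ ↑ʳ proj₂ a)) (pathArcs n₁)
  ++ map (λ j → (inject≤ j le ↑ˡ n₁ , n₂ ↑ʳ j)) (allFin n₁) )

{-# OPTIONS --safe #-}
-- Writing i = x + 1, a non-strict disposition of 𝔊 n₁ n₂ of size i is a pair of weakly
-- decreasing sequences, g on the v-path (length n₂) and h on the u-path (length n₁), with
-- entries ≤ x and h ≤ g termwise. Peeling off the first entries gives a double-sum recursion
-- for the number of such pairs. The reflection principle predicts the count
-- C(x+n₂,n₂)·C(x+n₁,n₁) − C(x+n₁,x+1)·C(x+n₂,n₂+1), and the hockey-stick identity and Pascal's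
-- rule show by induction that this closed form satisfies the recursion. By absorption the
-- subtracted term is n₁x/((n₂+1)(x+1)) times the first product, which is the stated formula.
module Submission where

open import Defs
open import Data.Nat
  using (ℕ; zero; suc; _+_; _*_; _∸_; _≤_; _<_; _⊓_; _≤ᵇ_; z≤n; s≤s; s≤s⁻¹; _≤′_; ≤′-refl; ≤′-step; NonZero)
open import Data.Nat.Properties
open import Data.Nat.Combinatorics using (_C_; nCk+nC[k+1]≡[n+1]C[k+1]; nCk≡nC[n∸k]; nC1≡n; nCn≡1; k>n⇒nCk≡0)
import Data.Nat.Tactic.RingSolver as ℕ-Solver
open import Algebra.Properties.CommutativeSemigroup +-commutativeSemigroup
  using () renaming (interchange to +-interchange)
open import Data.Bool using (Bool; true; false; _∧_; T)
open import Data.Bool.Properties using (T-∧; ∧-identityʳ)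
open import Data.Fin using (Fin; zero; suc; toℕ; inject₁; inject≤; _↑ˡ_; _↑ʳ_; splitAt)
import Data.Fin as Fin
import Data.Fin.Properties as Fin
open import Data.Fin.Properties using (toℕ<n)
import Data.Vec.Functional as VF
open import Data.Vec.Functional.Properties using (lookup-++ˡ; lookup-++ʳ)
open import Data.List using (List; []; _∷_; _++_; map; concatMap; length; filter; allFin)
open import Data.List.Properties using (map-tabulate)
open import Data.List.Relation.Unary.All as All using (All; []; _∷_)
import Data.List.Relation.Unary.All.Properties as All
open import Data.Product using (_×_; _,_; proj₁; proj₂)
open import Data.Sum using (inj₁; inj₂)
open import Data.Unit using (tt)
open import Function using (_∘_; id; const)
open import Function.Bundles using (_⇔_; mk⇔; Equivalence)
open import Function.Construct.Composition using (_⇔-∘_)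
open import Function.Construct.Symmetry using (⇔-sym)
open import Relation.Nullary using (Dec; ¬_; does; contradiction)
open import Relation.Nullary.Decidable using (does-⇔; T?)
open import Relation.Unary using (Decidable)
open import Relation.Binary.PropositionalEquality

open ≡-Reasoning

module _ {A : Set} where

  sumOver : List A → (A → ℕ) → ℕ
  sumOver []       f = 0
  sumOver (x ∷ xs) f = f x + sumOver xs f

  infixr 6.2 sumOver
  syntax sumOver xs (λ x → e) = ∑[ x ← xs ] e

  ∑-cong : ∀ xs {f g : A → ℕ} → (∀ x → f x ≡ g x) → ∑[ x ← xs ] f x ≡ ∑[ x ← xs ] g x
  ∑-cong []       f≗g = refl
  ∑-cong (x ∷ xs) f≗g = cong₂ _+_ (f≗g x) (∑-cong xs f≗g)

  ∑-zero : ∀ xs → ∑[ x ← xs ] 0 ≡ 0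
  ∑-zero []       = refl
  ∑-zero (x ∷ xs) = ∑-zero xs

  ∑-++ : ∀ xs ys (f : A → ℕ) → ∑[ z ← xs ++ ys ] f z ≡ ∑[ x ← xs ] f x + ∑[ y ← ys ] f y
  ∑-++ []       ys f = refl
  ∑-++ (x ∷ xs) ys f = trans (cong (f x +_) (∑-++ xs ys f)) (sym (+-assoc (f x) _ _))

  ∑-distrib-+ : ∀ xs (f g : A → ℕ) → ∑[ x ← xs ] (f x + g x) ≡ ∑[ x ← xs ] f x + ∑[ x ← xs ] g x
  ∑-distrib-+ []       f g = refl
  ∑-distrib-+ (x ∷ xs) f g = begin
    f x + g x + ∑[ y ← xs ] (f y + g y)                 ≡⟨ cong (f x + g x +_) (∑-distrib-+ xs f g) ⟩
    f x + g x + (∑[ y ← xs ] f y + ∑[ y ← xs ] g y)     ≡⟨ +-interchange (f x) (g x) _ _ ⟩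
    (f x + ∑[ y ← xs ] f y) + (g x + ∑[ y ← xs ] g y)   ∎

  *-distribˡ-∑ : ∀ c xs (f : A → ℕ) → c * (∑[ x ← xs ] f x) ≡ ∑[ x ← xs ] c * f x
  *-distribˡ-∑ c []       f = *-zeroʳ c
  *-distribˡ-∑ c (x ∷ xs) f = trans (*-distribˡ-+ c (f x) _) (cong (c * f x +_) (*-distribˡ-∑ c xs f))

module _ {A B : Set} where

  ∑-map : ∀ (φ : A → B) xs (f : B → ℕ) → ∑[ y ← map φ xs ] f y ≡ ∑[ x ← xs ] f (φ x)
  ∑-map φ []       f = refl
  ∑-map φ (x ∷ xs) f = cong (f (φ x) +_) (∑-map φ xs f)

  ∑-concatMap : ∀ (φ : A → List B) xs (f : B → ℕ) →
    ∑[ y ← concatMap φ xs ] f y ≡ ∑[ x ← xs ] ∑[ y ← φ x ] f y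
  ∑-concatMap φ []       f = refl
  ∑-concatMap φ (x ∷ xs) f = trans (∑-++ (φ x) (concatMap φ xs) f) (cong (∑[ y ← φ x ] f y +_) (∑-concatMap φ xs f))

  ∑-comm : ∀ xs ys (f : A → B → ℕ) → ∑[ x ← xs ] ∑[ y ← ys ] f x y ≡ ∑[ y ← ys ] ∑[ x ← xs ] f x y
  ∑-comm []       ys f = sym (∑-zero ys)
  ∑-comm (x ∷ xs) ys f = begin
    ∑[ y ← ys ] f x y + ∑[ x′ ← xs ] ∑[ y ← ys ] f x′ y   ≡⟨ cong (∑[ y ← ys ] f x y +_) (∑-comm xs ys f) ⟩
    ∑[ y ← ys ] f x y + ∑[ y ← ys ] ∑[ x′ ← xs ] f x′ y   ≡⟨ ∑-distrib-+ ys (f x) _ ⟨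
    ∑[ y ← ys ] (f x y + ∑[ x′ ← xs ] f x′ y)             ∎

sumUpTo : ℕ → (ℕ → ℕ) → ℕ
sumUpTo zero    f = f 0
sumUpTo (suc n) f = sumUpTo n f + f (suc n)

infixr 6.2 sumUpTo
syntax sumUpTo n (λ k → e) = ∑[ k ≤ n ] e

∑≤-cong : ∀ n {f g : ℕ → ℕ} → (∀ {k} → k ≤ n → f k ≡ g k) → ∑[ k ≤ n ] f k ≡ ∑[ k ≤ n ] g k
∑≤-cong zero    f≗g = f≗g z≤n
∑≤-cong (suc n) f≗g = cong₂ _+_ (∑≤-cong n (λ k≤n → f≗g (m≤n⇒m≤1+n k≤n))) (f≗g ≤-refl)

∑≤-distrib-+ : ∀ n (f g : ℕ → ℕ) → ∑[ k ≤ n ] (f k + g k) ≡ ∑[ k ≤ n ] f k + ∑[ k ≤ n ] g k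
∑≤-distrib-+ zero    f g = refl
∑≤-distrib-+ (suc n) f g = trans (cong (_+ (f (suc n) + g (suc n))) (∑≤-distrib-+ n f g))
                                  (+-interchange (∑[ k ≤ n ] f k) _ (f (suc n)) _)

*-distribˡ-∑≤ : ∀ c n (f : ℕ → ℕ) → c * (∑[ k ≤ n ] f k) ≡ ∑[ k ≤ n ] c * f k
*-distribˡ-∑≤ c zero    f = refl
*-distribˡ-∑≤ c (suc n) f = trans (*-distribˡ-+ c _ (f (suc n))) (cong (_+ c * f (suc n)) (*-distribˡ-∑≤ c n f))

∑≤-suc : ∀ n (f : ℕ → ℕ) → ∑[ k ≤ suc n ] f k ≡ f 0 + ∑[ k ≤ n ] f (suc k)
∑≤-suc zero    f = refl
∑≤-suc (suc n) f = trans (cong (_+ f (suc (suc n))) (∑≤-suc n f)) (+-assoc (f 0) _ _)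

C-sym : ∀ m n → (m + n) C m ≡ (m + n) C n
C-sym m n = trans (nCk≡nC[n∸k] (m≤m+n m n)) (cong ((m + n) C_) (m+n∸m≡n m n))

C-pascal : ∀ n k → suc n C suc k ≡ n C k + n C suc k
C-pascal n k = sym (nCk+nC[k+1]≡[n+1]C[k+1] n k)

C-above : ∀ {n k} → n ≤ k → n C suc k ≡ 0
C-above n≤k = k>n⇒nCk≡0 (s≤s n≤k)

C-absorb : ∀ k m → suc k * ((m + k) C suc k) ≡ m * ((m + k) C k)
C-absorb k       zero    = trans (cong (suc k *_) (C-above {k} ≤-refl)) (*-zeroʳ (suc k))
C-absorb zero    (suc m) = begin
  1 * ((suc m + 0) C 1)   ≡⟨ *-identityˡ _ ⟩
  (suc m + 0) C 1         ≡⟨ nC1≡n (suc m + 0) ⟩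
  suc m + 0               ≡⟨ +-identityʳ (suc m) ⟩
  suc m                   ≡⟨ *-identityʳ (suc m) ⟨
  suc m * 1               ∎
C-absorb (suc k) (suc m) = begin
  suc (suc k) * (suc n C suc (suc k))                             ≡⟨ cong (suc (suc k) *_) (C-pascal n (suc k)) ⟩
  suc (suc k) * (n C suc k + n C suc (suc k))                     ≡⟨ *-distribˡ-+ (suc (suc k)) (n C suc k) _ ⟩
  suc (suc k) * (n C suc k) + suc (suc k) * (n C suc (suc k))     ≡⟨ cong (suc (suc k) * (n C suc k) +_) (C-absorb (suc k) m) ⟩
  suc (suc k) * (n C suc k) + m * (n C suc k)                     ≡⟨ cong (λ z → n C suc k + z + m * (n C suc k)) smaller ⟩
  n C suc k + suc m * (n C k) + m * (n C suc k)                   ≡⟨ regroup (n C suc k) (n C k) m ⟩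
  suc m * (n C k + n C suc k)                                     ≡⟨ cong (suc m *_) (C-pascal n k) ⟨
  suc m * (suc n C suc k)                                         ∎
  where
  n : ℕ
  n = m + suc k
  smaller : suc k * (n C suc k) ≡ suc m * (n C k)
  smaller = subst (λ z → suc k * (z C suc k) ≡ suc m * (z C k)) (sym (+-suc m k)) (C-absorb k (suc m))
  regroup : ∀ a b m → a + suc m * b + m * a ≡ suc m * (b + a)
  regroup = ℕ-Solver.solve-∀

hockey-stick : ∀ {p k} → p ≤ k → ∀ m → ∑[ b ≤ m ] (b + p) C k ≡ (suc m + p) C suc k
hockey-stick {p} {k} p≤k zero    = begin
  p C k               ≡⟨ +-identityʳ (p C k) ⟨
  p C k + 0           ≡⟨ cong (p C k +_) (C-above p≤k) ⟨
  p C k + p C suc k   ≡⟨ C-pascal p k ⟨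
  suc p C suc k       ∎
hockey-stick {p} {k} p≤k (suc m) = begin
  ∑[ b ≤ m ] (b + p) C k + (suc m + p) C k   ≡⟨ cong (_+ (suc m + p) C k) (hockey-stick p≤k m) ⟩
  (suc m + p) C suc k + (suc m + p) C k      ≡⟨ +-comm ((suc m + p) C suc k) _ ⟩
  (suc m + p) C k + (suc m + p) C suc k      ≡⟨ C-pascal (suc m + p) k ⟨
  (suc (suc m) + p) C suc k                  ∎

chains : ℕ → ℕ → ℕ
chains zero    x = 1
chains (suc p) x = ∑[ a ≤ x ] chains p a

-- ballot p q x y counts pairs of weakly decreasing sequences g (length p, entries ≤ x) and
-- h (length q, entries ≤ y) with h ≤ g termwise.
ballot : ℕ → ℕ → ℕ → ℕ → ℕ
ballot p       zero    x y = chains p x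
ballot zero    (suc q) x y = 0
ballot (suc p) (suc q) x y = ∑[ a ≤ x ] ∑[ b ≤ a ⊓ y ] ballot p q a b

chains≡C : ∀ p x → chains p x ≡ (x + p) C p
chains≡C zero    x = refl
chains≡C (suc p) x = begin
  ∑[ a ≤ x ] chains p a    ≡⟨ ∑≤-cong x (λ {a} _ → chains≡C p a) ⟩
  ∑[ a ≤ x ] (a + p) C p   ≡⟨ hockey-stick {p} ≤-refl x ⟩
  (suc x + p) C suc p      ≡⟨ cong (_C suc p) (+-suc x p) ⟨
  (x + suc p) C suc p      ∎

BallotIdentity : ℕ → ℕ → ℕ → ℕ → Set
BallotIdentity p q x y =
  ballot p q x y + ((x + q) C suc x) * ((y + p) C suc p) ≡ ((x + p) C p) * ((y + q) C q)

BallotFormula : ℕ → ℕ → Set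
BallotFormula p q = ∀ {x y} → y ≤ x → BallotIdentity p q x y

add-row : ∀ {S R} α a g β b e → S + β * g ≡ a * b → R + e * g ≡ α * b →
  (S + R) + (β + e) * g ≡ (α + a) * b
add-row {S} {R} α a g β b e earlier last = begin
  (S + R) + (β + e) * g           ≡⟨ expand S R β e g ⟩
  (S + β * g) + (R + e * g)       ≡⟨ cong₂ _+_ earlier last ⟩
  a * b + α * b                   ≡⟨ *-distribʳ-+ b a α ⟨
  (a + α) * b                     ≡⟨ cong (_* b) (+-comm a α) ⟩
  (α + a) * b                     ∎
  where
  expand : ∀ S R β e g → (S + R) + (β + e) * g ≡ (S + β * g) + (R + e * g)
  expand = ℕ-Solver.solve-∀

add-row-split : ∀ {S R} α a g β b e → S + β * g ≡ a * b → R + e * (a + g) ≡ α * (β + b) →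
  (S + R) + (β + e) * (a + g) ≡ (α + a) * (β + b)
add-row-split {S} {R} α a g β b e earlier last = begin
  (S + R) + (β + e) * (a + g)                ≡⟨ expand S R β e a g ⟩
  (S + β * g) + (R + e * (a + g)) + β * a    ≡⟨ cong₂ (λ u v → u + v + β * a) earlier last ⟩
  a * b + α * (β + b) + β * a                ≡⟨ collect a b α β ⟩
  (α + a) * (β + b)                          ∎
  where
  expand : ∀ S R β e a g → (S + R) + (β + e) * (a + g) ≡ (S + β * g) + (R + e * (a + g)) + β * a
  expand = ℕ-Solver.solve-∀
  collect : ∀ a b α β → a * b + α * (β + b) + β * a ≡ (α + a) * (β + b)
  collect = ℕ-Solver.solve-∀

module BallotStep (p q : ℕ) (formula : BallotFormula p q) where

  row-formula : ∀ x {m} → m ≤ suc x →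
    ∑[ b ≤ m ] ballot p q (suc x) b + ((x + suc q) C suc (suc x)) * ((m + suc p) C suc (suc p))
      ≡ ((x + suc p) C p) * ((m + suc q) C suc q)
  row-formula x {m} m≤1+x = begin
    ∑[ b ≤ m ] ballot p q (suc x) b + e * ((m + suc p) C suc (suc p))
      ≡⟨ cong (λ z → ∑[ b ≤ m ] ballot p q (suc x) b + e * (z C suc (suc p))) (+-suc m p) ⟩
    ∑[ b ≤ m ] ballot p q (suc x) b + e * ((suc m + p) C suc (suc p))
      ≡⟨ cong (λ z → ∑[ b ≤ m ] ballot p q (suc x) b + e * z) (hockey-stick (n≤1+n p) m) ⟨
    ∑[ b ≤ m ] ballot p q (suc x) b + e * (∑[ b ≤ m ] (b + p) C suc p)
      ≡⟨ cong (∑[ b ≤ m ] ballot p q (suc x) b +_) (*-distribˡ-∑≤ e m _) ⟩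
    ∑[ b ≤ m ] ballot p q (suc x) b + ∑[ b ≤ m ] e * ((b + p) C suc p)
      ≡⟨ ∑≤-distrib-+ m _ _ ⟨
    ∑[ b ≤ m ] (ballot p q (suc x) b + e * ((b + p) C suc p))
      ≡⟨ ∑≤-cong m (λ b≤m → shifted-formula (≤-trans b≤m m≤1+x)) ⟩
    ∑[ b ≤ m ] f * ((b + q) C q)
      ≡⟨ *-distribˡ-∑≤ f m _ ⟨
    f * (∑[ b ≤ m ] (b + q) C q)
      ≡⟨ cong (f *_) (hockey-stick {q} ≤-refl m) ⟩
    f * ((suc m + q) C suc q)
      ≡⟨ cong (λ z → f * (z C suc q)) (+-suc m q) ⟨
    f * ((m + suc q) C suc q)
      ∎
    where
    e f : ℕ
    e = (x + suc q) C suc (suc x)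
    f = (x + suc p) C p
    shifted-formula : ∀ {b} → b ≤ suc x → ballot p q (suc x) b + e * ((b + p) C suc p) ≡ f * ((b + q) C q)
    shifted-formula {b} b≤1+x =
      subst₂ (λ u v → ballot p q (suc x) b + (u C suc (suc x)) * ((b + p) C suc p) ≡ (v C p) * ((b + q) C q))
             (sym (+-suc x q)) (sym (+-suc x p)) (formula b≤1+x)

  diagonal : ∀ y → BallotIdentity (suc p) (suc q) y y
  diagonal zero = begin
    ballot p q 0 0 + ((0 + suc q) C 1) * ((0 + suc p) C suc (suc p))
      ≡⟨ cong (λ z → ballot p q 0 0 + ((0 + suc q) C 1) * z) (C-above {suc p} ≤-refl) ⟩
    ballot p q 0 0 + ((0 + suc q) C 1) * 0
      ≡⟨ cong (ballot p q 0 0 +_) (trans (*-zeroʳ ((0 + suc q) C 1)) (sym (*-zeroʳ (q C 1)))) ⟩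
    ballot p q 0 0 + (q C 1) * 0
      ≡⟨ cong (λ z → ballot p q 0 0 + (q C 1) * z) (C-above {p} ≤-refl) ⟨
    ballot p q 0 0 + (q C 1) * (p C suc p)
      ≡⟨ formula z≤n ⟩
    (p C p) * (q C q)
      ≡⟨ cong₂ _*_ (trans (nCn≡1 p) (sym (nCn≡1 (suc p)))) (trans (nCn≡1 q) (sym (nCn≡1 (suc q)))) ⟩
    (suc p C suc p) * (suc q C suc q)
      ∎
  diagonal (suc y) = begin
    ballot (suc p) (suc q) (suc y) (suc y) + ((suc y + suc q) C suc (suc y)) * ((suc y + suc p) C suc (suc p))
      ≡⟨ cong₂ _+_ (cong₂ _+_ earlier-rows last-row)
               (cong₂ _*_ (C-pascal (y + suc q) (suc y)) (C-pascal (y + suc p) (suc p))) ⟩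
    (ballot (suc p) (suc q) y y + ∑[ b ≤ suc y ] ballot p q (suc y) b) + (β + e) * (a + g)
      ≡⟨ add-row-split α a g β b e (diagonal y) row ⟩
    (α + a) * (β + b)
      ≡⟨ cong₂ _*_ (C-pascal (y + suc p) p) (trans (C-pascal (y + suc q) q) (cong (_+ b) β-sym)) ⟨
    ((suc y + suc p) C suc p) * ((suc y + suc q) C suc q)
      ∎
    where
    α a g β b e : ℕ
    α = (y + suc p) C p
    a = (y + suc p) C suc p
    g = (y + suc p) C suc (suc p)
    β = (y + suc q) C suc y
    b = (y + suc q) C suc q
    e = (y + suc q) C suc (suc y)
    earlier-rows : ∑[ a′ ≤ y ] ∑[ b′ ≤ a′ ⊓ suc y ] ballot p q a′ b′ ≡ ballot (suc p) (suc q) y y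
    earlier-rows = ∑≤-cong y (λ {a′} a′≤y → cong (λ m → ∑[ b′ ≤ m ] ballot p q a′ b′)
                     (trans (m≤n⇒m⊓n≡m (m≤n⇒m≤1+n a′≤y)) (sym (m≤n⇒m⊓n≡m a′≤y))))
    last-row : ∑[ b′ ≤ suc y ⊓ suc y ] ballot p q (suc y) b′ ≡ ∑[ b′ ≤ suc y ] ballot p q (suc y) b′
    last-row = cong (λ m → ∑[ b′ ≤ m ] ballot p q (suc y) b′) (⊓-idem (suc y))
    β-sym : (y + suc q) C q ≡ β
    β-sym = subst (λ n → n C q ≡ n C suc y) (sym (+-suc y q)) (sym (C-sym (suc y) q))
    row : ∑[ b′ ≤ suc y ] ballot p q (suc y) b′ + e * (a + g) ≡ α * (β + b)
    row = subst₂ (λ u v → ∑[ b′ ≤ suc y ] ballot p q (suc y) b′ + e * u ≡ α * v)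
            (C-pascal (y + suc p) (suc p)) (trans (C-pascal (y + suc q) q) (cong (_+ b) β-sym))
            (row-formula y ≤-refl)

  below-diagonal : ∀ {x y} → y ≤′ x → BallotIdentity (suc p) (suc q) x y
  below-diagonal {y = y} ≤′-refl = diagonal y
  below-diagonal {suc x} {y} (≤′-step y≤′x) = begin
    ballot (suc p) (suc q) (suc x) y + ((suc x + suc q) C suc (suc x)) * g
      ≡⟨ cong₂ _+_ (cong (ballot (suc p) (suc q) x y +_) last-row) (cong (_* g) (C-pascal (x + suc q) (suc x))) ⟩
    (ballot (suc p) (suc q) x y + ∑[ b′ ≤ y ] ballot p q (suc x) b′) + (β + e) * g
      ≡⟨ add-row α a g β b e (below-diagonal y≤′x) (row-formula x (m≤n⇒m≤1+n y≤x)) ⟩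
    (α + a) * b
      ≡⟨ cong (_* b) (C-pascal (x + suc p) p) ⟨
    ((suc x + suc p) C suc p) * b
      ∎
    where
    y≤x : y ≤ x
    y≤x = ≤′⇒≤ y≤′x
    α a g β b e : ℕ
    α = (x + suc p) C p
    a = (x + suc p) C suc p
    g = (y + suc p) C suc (suc p)
    β = (x + suc q) C suc x
    b = (y + suc q) C suc q
    e = (x + suc q) C suc (suc x)
    last-row : ∑[ b′ ≤ suc x ⊓ y ] ballot p q (suc x) b′ ≡ ∑[ b′ ≤ y ] ballot p q (suc x) b′
    last-row = cong (λ m → ∑[ b′ ≤ m ] ballot p q (suc x) b′) (m≥n⇒m⊓n≡n (m≤n⇒m≤1+n y≤x))

ballot-formula : ∀ {p q} → q ≤ p → BallotFormula p q
ballot-formula {p} {zero} _ {x} {y} _ = begin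
  chains p x + ((x + 0) C suc x) * ((y + p) C suc p)   ≡⟨ cong₂ (λ u v → u + v * ((y + p) C suc p)) (chains≡C p x) no-crossings ⟩
  (x + p) C p + 0                                      ≡⟨ +-identityʳ _ ⟩
  (x + p) C p                                          ≡⟨ *-identityʳ _ ⟨
  ((x + p) C p) * 1                                    ∎
  where
  no-crossings : (x + 0) C suc x ≡ 0
  no-crossings = C-above (≤-reflexive (+-identityʳ x))
ballot-formula {suc p} {suc q} (s≤s q≤p) y≤x = BallotStep.below-diagonal p q (ballot-formula q≤p) (≤⇒≤′ y≤x)

𝟙 : Bool → ℕ
𝟙 true  = 1
𝟙 false = 0

𝟙-∧ : ∀ a b → 𝟙 (a ∧ b) ≡ 𝟙 a * 𝟙 b
𝟙-∧ true  b = sym (*-identityˡ (𝟙 b))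
𝟙-∧ false b = refl

𝟙-true : ∀ {b} → T b → 𝟙 b ≡ 1
𝟙-true {true} _ = refl

𝟙-false : ∀ {b} → ¬ T b → 𝟙 b ≡ 0
𝟙-false {true}  ¬b = contradiction tt ¬b
𝟙-false {false} _  = refl

length-filter≡∑ : ∀ {A : Set} {P : A → Set} (P? : Decidable P) xs →
  length (filter P? xs) ≡ ∑[ x ← xs ] 𝟙 (does (P? x))
length-filter≡∑ P? []       = refl
length-filter≡∑ P? (x ∷ xs) with does (P? x)
... | true  = cong suc (length-filter≡∑ P? xs)
... | false = length-filter≡∑ P? xs

∑-allFin-suc : ∀ n (F : Fin (suc n) → ℕ) → ∑[ a ← allFin (suc n) ] F a ≡ F zero + ∑[ a ← allFin n ] F (suc a)
∑-allFin-suc n F = cong (F zero +_) (trans (cong (λ as → ∑[ a ← as ] F a) (sym (map-tabulate id suc))) (∑-map suc (allFin n) F))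

∑-allFin-≤ : ∀ {i m} (c : ℕ → Bool) → (∀ k → T (c k) ⇔ k ≤ m) → m < i → (F : ℕ → ℕ) →
  ∑[ a ← allFin i ] 𝟙 (c (toℕ a)) * F (toℕ a) ≡ ∑[ k ≤ m ] F k
∑-allFin-≤ {suc i} {zero} c c⇔ _ F = begin
  ∑[ a ← allFin (suc i) ] 𝟙 (c (toℕ a)) * F (toℕ a)
    ≡⟨ ∑-allFin-suc i _ ⟩
  𝟙 (c 0) * F 0 + ∑[ a ← allFin i ] 𝟙 (c (suc (toℕ a))) * F (suc (toℕ a))
    ≡⟨ cong₂ _+_ (cong (_* F 0) (𝟙-true (Equivalence.from (c⇔ 0) z≤n)))
                 (trans (∑-cong (allFin i) (λ a → cong (_* F (suc (toℕ a))) (𝟙-false (n≮0 ∘ Equivalence.to (c⇔ _)))))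
                        (∑-zero (allFin i))) ⟩
  1 * F 0 + 0
    ≡⟨ trans (+-identityʳ _) (*-identityˡ (F 0)) ⟩
  F 0 ∎
∑-allFin-≤ {suc i} {suc m} c c⇔ (s≤s m<i) F = begin
  ∑[ a ← allFin (suc i) ] 𝟙 (c (toℕ a)) * F (toℕ a)
    ≡⟨ ∑-allFin-suc i _ ⟩
  𝟙 (c 0) * F 0 + ∑[ a ← allFin i ] 𝟙 (c (suc (toℕ a))) * F (suc (toℕ a))
    ≡⟨ cong₂ _+_ (trans (cong (_* F 0) (𝟙-true (Equivalence.from (c⇔ 0) z≤n))) (*-identityˡ (F 0)))
                 (∑-allFin-≤ (c ∘ suc) c⇔′ m<i (F ∘ suc)) ⟩
  F 0 + ∑[ k ≤ m ] F (suc k)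
    ≡⟨ ∑≤-suc m F ⟨
  ∑[ k ≤ suc m ] F k ∎
  where c⇔′ : ∀ k → T (c (suc k)) ⇔ k ≤ m
        c⇔′ k = mk⇔ (s≤s⁻¹ ∘ Equivalence.to (c⇔ (suc k))) (Equivalence.from (c⇔ (suc k)) ∘ s≤s)

∑-allFuns-suc : ∀ n i (F : (Fin (suc n) → Fin i) → ℕ) →
  ∑[ f ← allFuns (suc n) i ] F f ≡ ∑[ a ← allFin i ] ∑[ f ← allFuns n i ] F (a VF.∷ f)
∑-allFuns-suc n i F = trans (∑-concatMap _ (allFin i) F) (∑-cong (allFin i) (λ a → ∑-map (a VF.∷_) (allFuns n i) F))

∷-++ : ∀ {i m n} (a : Fin i) (g : Fin m → Fin i) (h : Fin n → Fin i) → (a VF.∷ (g VF.++ h)) ≗ ((a VF.∷ g) VF.++ h)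
∷-++     a g h zero    = refl
∷-++ {m = m} a g h (suc j) with splitAt m j
... | inj₁ _ = refl
... | inj₂ _ = refl

∑-allFuns-++ : ∀ m n i (F : (Fin (m + n) → Fin i) → ℕ) → (∀ {f f′} → f ≗ f′ → F f ≡ F f′) →
  ∑[ f ← allFuns (m + n) i ] F f ≡ ∑[ g ← allFuns m i ] ∑[ h ← allFuns n i ] F (g VF.++ h)
∑-allFuns-++ zero    n i F F-cong = sym (+-identityʳ _)
∑-allFuns-++ (suc m) n i F F-cong = begin
  ∑[ f ← allFuns (suc (m + n)) i ] F f
    ≡⟨ ∑-allFuns-suc (m + n) i F ⟩
  ∑[ a ← allFin i ] ∑[ f ← allFuns (m + n) i ] F (a VF.∷ f)
    ≡⟨ ∑-cong (allFin i) (λ a → ∑-allFuns-++ m n i (F ∘ (a VF.∷_))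
                                   (λ f≗f′ → F-cong (λ { zero → refl ; (suc j) → f≗f′ j }))) ⟩
  ∑[ a ← allFin i ] ∑[ g ← allFuns m i ] ∑[ h ← allFuns n i ] F (a VF.∷ (g VF.++ h))
    ≡⟨ ∑-cong (allFin i) (λ a → ∑-cong (allFuns m i) (λ g → ∑-cong (allFuns n i) (λ h → F-cong (∷-++ a g h)))) ⟩
  ∑[ a ← allFin i ] ∑[ g ← allFuns m i ] ∑[ h ← allFuns n i ] F ((a VF.∷ g) VF.++ h)
    ≡⟨ ∑-allFuns-suc m i _ ⟨
  ∑[ g ← allFuns (suc m) i ] ∑[ h ← allFuns n i ] F (g VF.++ h)
    ∎

chainᵇ : ∀ {p i} → ℕ → (Fin p → Fin i) → Bool
chainᵇ {zero}  x g = true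
chainᵇ {suc p} x g = (toℕ (g zero) ≤ᵇ x) ∧ chainᵇ (toℕ (g zero)) (VF.tail g)

dominatesᵇ : ∀ {p q i} → (Fin p → Fin i) → (Fin q → Fin i) → Bool
dominatesᵇ {_}     {zero}  g h = true
dominatesᵇ {zero}  {suc q} g h = false
dominatesᵇ {suc p} {suc q} g h = (toℕ (h zero) ≤ᵇ toℕ (g zero)) ∧ dominatesᵇ (VF.tail g) (VF.tail h)

ballotᵇ : ∀ {p q i} → ℕ → ℕ → (Fin p → Fin i) → (Fin q → Fin i) → Bool
ballotᵇ x y g h = chainᵇ x g ∧ (chainᵇ y h ∧ dominatesᵇ g h)

ballotCount : (i p q x y : ℕ) → ℕ
ballotCount i p q x y = ∑[ g ← allFuns p i ] ∑[ h ← allFuns q i ] 𝟙 (ballotᵇ x y g h)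

≤ᵇ⇔ : ∀ m k → T (k ≤ᵇ m) ⇔ k ≤ m
≤ᵇ⇔ m k = mk⇔ (≤ᵇ⇒≤ k m) ≤⇒≤ᵇ

chainCount≡chains : ∀ {i} p {x} → x < i → ∑[ g ← allFuns p i ] 𝟙 (chainᵇ x g) ≡ chains p x
chainCount≡chains         zero    _   = refl
chainCount≡chains {i} (suc p) {x} x<i = begin
  ∑[ g ← allFuns (suc p) i ] 𝟙 (chainᵇ x g)
    ≡⟨ ∑-allFuns-suc p i _ ⟩
  ∑[ a ← allFin i ] ∑[ g ← allFuns p i ] 𝟙 ((toℕ a ≤ᵇ x) ∧ chainᵇ (toℕ a) g)
    ≡⟨ ∑-cong (allFin i) fixed-head ⟩
  ∑[ a ← allFin i ] 𝟙 (toℕ a ≤ᵇ x) * chains p (toℕ a)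
    ≡⟨ ∑-allFin-≤ (_≤ᵇ x) (≤ᵇ⇔ x) x<i (chains p) ⟩
  ∑[ a ≤ x ] chains p a
    ∎
  where
  fixed-head : ∀ a → ∑[ g ← allFuns p i ] 𝟙 ((toℕ a ≤ᵇ x) ∧ chainᵇ (toℕ a) g) ≡ 𝟙 (toℕ a ≤ᵇ x) * chains p (toℕ a)
  fixed-head a = begin
    ∑[ g ← allFuns p i ] 𝟙 ((toℕ a ≤ᵇ x) ∧ chainᵇ (toℕ a) g)
      ≡⟨ ∑-cong (allFuns p i) (λ g → 𝟙-∧ _ (chainᵇ (toℕ a) g)) ⟩
    ∑[ g ← allFuns p i ] 𝟙 (toℕ a ≤ᵇ x) * 𝟙 (chainᵇ (toℕ a) g)
      ≡⟨ *-distribˡ-∑ (𝟙 (toℕ a ≤ᵇ x)) (allFuns p i) _ ⟨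
    𝟙 (toℕ a ≤ᵇ x) * (∑[ g ← allFuns p i ] 𝟙 (chainᵇ (toℕ a) g))
      ≡⟨ cong (𝟙 (toℕ a ≤ᵇ x) *_) (chainCount≡chains p (toℕ<n a)) ⟩
    𝟙 (toℕ a ≤ᵇ x) * chains p (toℕ a)
      ∎

𝟙-ballotᵇ-∷ : ∀ {p q i} x y (a b : Fin i) (g : Fin p → Fin i) (h : Fin q → Fin i) →
  𝟙 (ballotᵇ x y (a VF.∷ g) (b VF.∷ h))
    ≡ (𝟙 (toℕ a ≤ᵇ x) * 𝟙 ((toℕ b ≤ᵇ y) ∧ (toℕ b ≤ᵇ toℕ a))) * 𝟙 (ballotᵇ (toℕ a) (toℕ b) g h)
𝟙-ballotᵇ-∷ x y a b g h = begin
  𝟙 ((A ∧ G) ∧ ((B ∧ H) ∧ (D ∧ R)))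
    ≡⟨ trans (𝟙-∧ (A ∧ G) _)
             (cong₂ _*_ (𝟙-∧ A G) (trans (𝟙-∧ (B ∧ H) (D ∧ R)) (cong₂ _*_ (𝟙-∧ B H) (𝟙-∧ D R)))) ⟩
  (𝟙 A * 𝟙 G) * ((𝟙 B * 𝟙 H) * (𝟙 D * 𝟙 R))
    ≡⟨ regroup (𝟙 A) (𝟙 G) (𝟙 B) (𝟙 H) (𝟙 D) (𝟙 R) ⟩
  (𝟙 A * (𝟙 B * 𝟙 D)) * (𝟙 G * (𝟙 H * 𝟙 R))
    ≡⟨ sym (cong₂ _*_ (cong (𝟙 A *_) (𝟙-∧ B D)) (trans (𝟙-∧ G (H ∧ R)) (cong (𝟙 G *_) (𝟙-∧ H R)))) ⟩
  (𝟙 A * 𝟙 (B ∧ D)) * 𝟙 (G ∧ (H ∧ R))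
    ∎
  where
  A G B H D R : Bool
  A = toℕ a ≤ᵇ x
  G = chainᵇ (toℕ a) g
  B = toℕ b ≤ᵇ y
  H = chainᵇ (toℕ b) h
  D = toℕ b ≤ᵇ toℕ a
  R = dominatesᵇ g h
  regroup : ∀ a g b h d r → (a * g) * ((b * h) * (d * r)) ≡ (a * (b * d)) * (g * (h * r))
  regroup = ℕ-Solver.solve-∀

≤ᵇ-∧-⇔ : ∀ a y k → T ((k ≤ᵇ y) ∧ (k ≤ᵇ a)) ⇔ k ≤ a ⊓ y
≤ᵇ-∧-⇔ a y k = mk⇔ to from
  where
  to : T ((k ≤ᵇ y) ∧ (k ≤ᵇ a)) → k ≤ a ⊓ y
  to t with Equivalence.to T-∧ t
  ... | k≤y , k≤a = ⊓-glb (≤ᵇ⇒≤ k a k≤a) (≤ᵇ⇒≤ k y k≤y)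
  from : k ≤ a ⊓ y → T ((k ≤ᵇ y) ∧ (k ≤ᵇ a))
  from k≤a⊓y = Equivalence.from T-∧ (≤⇒≤ᵇ (≤-trans k≤a⊓y (m⊓n≤n a y)) , ≤⇒≤ᵇ (≤-trans k≤a⊓y (m⊓n≤m a y)))

ballotCount≡ballot : ∀ {i p q} → q ≤ p → ∀ {x y} → x < i → ballotCount i p q x y ≡ ballot p q x y
ballotCount≡ballot {i} {p} {zero} _ {x} x<i =
  trans (∑-cong (allFuns p i) (λ g → trans (+-identityʳ _) (cong 𝟙 (∧-identityʳ (chainᵇ x g))))) (chainCount≡chains p x<i)
ballotCount≡ballot {i} {suc p} {suc q} (s≤s q≤p) {x} {y} x<i = begin
  ∑[ G ← allFuns (suc p) i ] ∑[ H ← allFuns (suc q) i ] 𝟙 (ballotᵇ x y G H)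
    ≡⟨ ∑-cong (allFuns (suc p) i) (λ G → ∑-allFuns-suc q i _) ⟩
  ∑[ G ← allFuns (suc p) i ] ∑[ b ← allFin i ] ∑[ h ← allFuns q i ] 𝟙 (ballotᵇ x y G (b VF.∷ h))
    ≡⟨ ∑-allFuns-suc p i _ ⟩
  ∑[ a ← allFin i ] ∑[ g ← allFuns p i ] ∑[ b ← allFin i ] ∑[ h ← allFuns q i ] 𝟙 (ballotᵇ x y (a VF.∷ g) (b VF.∷ h))
    ≡⟨ ∑-cong (allFin i) (λ a → ∑-comm (allFuns p i) (allFin i) _) ⟩
  ∑[ a ← allFin i ] ∑[ b ← allFin i ] ∑[ g ← allFuns p i ] ∑[ h ← allFuns q i ] 𝟙 (ballotᵇ x y (a VF.∷ g) (b VF.∷ h))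
    ≡⟨ ∑-cong (allFin i) (λ a → ∑-cong (allFin i) (λ b → fixed-heads a b)) ⟩
  ∑[ a ← allFin i ] ∑[ b ← allFin i ] (𝟙 (A a) * 𝟙 (B a b)) * ballot p q (toℕ a) (toℕ b)
    ≡⟨ ∑-cong (allFin i) (λ a → trans (∑-cong (allFin i) (λ b → *-assoc (𝟙 (A a)) _ _))
                                        (sym (*-distribˡ-∑ (𝟙 (A a)) (allFin i) _))) ⟩
  ∑[ a ← allFin i ] 𝟙 (A a) * (∑[ b ← allFin i ] 𝟙 (B a b) * ballot p q (toℕ a) (toℕ b))
    ≡⟨ ∑-cong (allFin i) (λ a → cong (𝟙 (A a) *_)
         (∑-allFin-≤ _ (≤ᵇ-∧-⇔ (toℕ a) y) (≤-<-trans (m⊓n≤m (toℕ a) y) (toℕ<n a)) (ballot p q (toℕ a)))) ⟩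
  ∑[ a ← allFin i ] 𝟙 (A a) * (∑[ b ≤ toℕ a ⊓ y ] ballot p q (toℕ a) b)
    ≡⟨ ∑-allFin-≤ (_≤ᵇ x) (≤ᵇ⇔ x) x<i _ ⟩
  ∑[ a ≤ x ] ∑[ b ≤ a ⊓ y ] ballot p q a b
    ∎
  where
  A : Fin i → Bool
  A a = toℕ a ≤ᵇ x
  B : Fin i → Fin i → Bool
  B a b = (toℕ b ≤ᵇ y) ∧ (toℕ b ≤ᵇ toℕ a)
  fixed-heads : ∀ a b → ∑[ g ← allFuns p i ] ∑[ h ← allFuns q i ] 𝟙 (ballotᵇ x y (a VF.∷ g) (b VF.∷ h))
                          ≡ (𝟙 (A a) * 𝟙 (B a b)) * ballot p q (toℕ a) (toℕ b)
  fixed-heads a b = begin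
    ∑[ g ← allFuns p i ] ∑[ h ← allFuns q i ] 𝟙 (ballotᵇ x y (a VF.∷ g) (b VF.∷ h))
      ≡⟨ ∑-cong (allFuns p i) (λ g → trans (∑-cong (allFuns q i) (𝟙-ballotᵇ-∷ x y a b g))
                                            (sym (*-distribˡ-∑ c (allFuns q i) _))) ⟩
    ∑[ g ← allFuns p i ] c * (∑[ h ← allFuns q i ] 𝟙 (ballotᵇ (toℕ a) (toℕ b) g h))
      ≡⟨ *-distribˡ-∑ c (allFuns p i) _ ⟨
    c * ballotCount i p q (toℕ a) (toℕ b)
      ≡⟨ cong (c *_) (ballotCount≡ballot q≤p (toℕ<n a)) ⟩
    c * ballot p q (toℕ a) (toℕ b)
      ∎
    where
    c : ℕ
    c = 𝟙 (A a) * 𝟙 (B a b)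

NonIncreasingAlong : ∀ {n i} → (Fin n → Fin i) → Fin n × Fin n → Set
NonIncreasingAlong f a = f (proj₂ a) Fin.≤ f (proj₁ a)

Descending : ∀ {m i} → (Fin (suc m) → Fin i) → Set
Descending g = ∀ j → g (suc j) Fin.≤ g (inject₁ j)

Fin-≤-⇔ : ∀ {i} {a a′ b b′ : Fin i} → a ≡ a′ → b ≡ b′ → (a Fin.≤ b) ⇔ (a′ Fin.≤ b′)
Fin-≤-⇔ refl refl = mk⇔ id id

All-map-⇔ : ∀ {A B : Set} {P : B → Set} {Q : A → Set} {φ : A → B} →
  (∀ a → P (φ a) ⇔ Q a) → ∀ xs → All P (map φ xs) ⇔ All Q xs
All-map-⇔ P⇔Q xs = mk⇔ (All.map (λ {a} → Equivalence.to (P⇔Q a)) ∘ All.map⁻)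
                       (All.map⁺ ∘ All.map (λ {a} → Equivalence.from (P⇔Q a)))

All-allFin-⇔ : ∀ {n} {P : Fin n → Set} → All P (allFin n) ⇔ (∀ j → P j)
All-allFin-⇔ = mk⇔ All.tabulate⁻ All.tabulate⁺

chainᵇ-suc-⇔ : ∀ {m i x} (g : Fin (suc m) → Fin i) → T (chainᵇ x g) ⇔ (toℕ (g zero) ≤ x × Descending g)
chainᵇ-suc-⇔ {zero}  g = mk⇔ (λ t → ≤ᵇ⇒≤ _ _ (proj₁ (Equivalence.to T-∧ t)) , λ ())
                             (λ (g₀≤x , _) → Equivalence.from T-∧ (≤⇒≤ᵇ g₀≤x , tt))
chainᵇ-suc-⇔ {suc m} {x = x} g = mk⇔ to from
  where
  tail-⇔ : T (chainᵇ (toℕ (g zero)) (VF.tail g)) ⇔ (toℕ (g (suc zero)) ≤ toℕ (g zero) × Descending (VF.tail g))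
  tail-⇔ = chainᵇ-suc-⇔ (VF.tail g)
  to : T (chainᵇ x g) → toℕ (g zero) ≤ x × Descending g
  to t with Equivalence.to T-∧ t
  ... | g₀≤x , rest with Equivalence.to tail-⇔ rest
  ...   | g₁≤g₀ , desc = ≤ᵇ⇒≤ _ _ g₀≤x , λ { zero → g₁≤g₀ ; (suc j) → desc j }
  from : toℕ (g zero) ≤ x × Descending g → T (chainᵇ x g)
  from (g₀≤x , desc) = Equivalence.from T-∧ (≤⇒≤ᵇ g₀≤x , Equivalence.from tail-⇔ (desc zero , desc ∘ suc))

pathArcs-⇔ : ∀ {p x} (g : Fin p → Fin (suc x)) → All (NonIncreasingAlong g) (pathArcs p) ⇔ T (chainᵇ x g)
pathArcs-⇔ {zero}  g = mk⇔ (const tt) (const [])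
pathArcs-⇔ {suc m} {x} g = mk⇔ (λ A → Equivalence.from (chainᵇ-suc-⇔ g) (bounded , Equivalence.to arcs⇔ A))
                           (λ t → Equivalence.from arcs⇔ (proj₂ (Equivalence.to (chainᵇ-suc-⇔ g) t)))
  where
  arcs⇔ : All (NonIncreasingAlong g) (pathArcs (suc m)) ⇔ Descending g
  arcs⇔ = All-allFin-⇔ ⇔-∘ All-map-⇔ (λ _ → mk⇔ id id) (allFin m)
  bounded : toℕ (g zero) ≤ x
  bounded = s≤s⁻¹ (toℕ<n (g zero))

embedded-pathArcs-⇔ : ∀ {p n i} (e : Fin p → Fin n) {f : Fin n → Fin i} {g : Fin p → Fin i} → (∀ k → f (e k) ≡ g k) →
  All (NonIncreasingAlong f) (map (λ a → (e (proj₁ a) , e (proj₂ a))) (pathArcs p)) ⇔ All (NonIncreasingAlong g) (pathArcs p)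
embedded-pathArcs-⇔ e fe≗g = All-map-⇔ (λ a → Fin-≤-⇔ (fe≗g (proj₂ a)) (fe≗g (proj₁ a))) _

dominatesᵇ-⇔ : ∀ {p q i} (le : q ≤ p) (g : Fin p → Fin i) (h : Fin q → Fin i) →
  T (dominatesᵇ g h) ⇔ (∀ j → h j Fin.≤ g (inject≤ j le))
dominatesᵇ-⇔ {q = zero}        _         g h = mk⇔ (λ _ ()) (const tt)
dominatesᵇ-⇔ {suc p} {suc q} (s≤s le) g h = mk⇔ to from
  where
  tail-⇔ : T (dominatesᵇ (VF.tail g) (VF.tail h)) ⇔ (∀ j → h (suc j) Fin.≤ g (suc (inject≤ j le)))
  tail-⇔ = dominatesᵇ-⇔ le (VF.tail g) (VF.tail h)
  to : T (dominatesᵇ g h) → ∀ j → h j Fin.≤ g (inject≤ j (s≤s le))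
  to t with Equivalence.to T-∧ t
  ... | h₀≤g₀ , rest = λ { zero → ≤ᵇ⇒≤ _ _ h₀≤g₀ ; (suc j) → Equivalence.to tail-⇔ rest j }
  from : (∀ j → h j Fin.≤ g (inject≤ j (s≤s le))) → T (dominatesᵇ g h)
  from h≤g = Equivalence.from T-∧ (≤⇒≤ᵇ (h≤g zero) , Equivalence.from tail-⇔ (h≤g ∘ suc))

disposition-⇔ : ∀ {n₁ n₂ x} (le : n₁ ≤ n₂) (g : Fin n₂ → Fin (suc x)) (h : Fin n₁ → Fin (suc x)) →
  IsNonStrictDisposition (𝔊 n₁ n₂ le) (suc x) (g VF.++ h) ⇔ T (ballotᵇ x x g h)
disposition-⇔ {n₁} {n₂} {x} le g h = mk⇔ to from
  where
  f : Fin (n₂ + n₁) → Fin (suc x)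
  f = g VF.++ h
  L₁ L₂ L₃ : List (Fin (n₂ + n₁) × Fin (n₂ + n₁))
  L₁ = map (λ a → (proj₁ a ↑ˡ n₁ , proj₂ a ↑ˡ n₁)) (pathArcs n₂)
  L₂ = map (λ a → (n₂ ↑ʳ proj₁ a , n₂ ↑ʳ proj₂ a)) (pathArcs n₁)
  L₃ = map (λ j → (inject≤ j le ↑ˡ n₁ , n₂ ↑ʳ j)) (allFin n₁)
  path-g : All (NonIncreasingAlong f) L₁ ⇔ T (chainᵇ x g)
  path-g = pathArcs-⇔ g ⇔-∘ embedded-pathArcs-⇔ (_↑ˡ n₁) (lookup-++ˡ g h)
  path-h : All (NonIncreasingAlong f) L₂ ⇔ T (chainᵇ x h)
  path-h = pathArcs-⇔ h ⇔-∘ embedded-pathArcs-⇔ (n₂ ↑ʳ_) (lookup-++ʳ g h)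
  rungs : All (NonIncreasingAlong f) L₃ ⇔ T (dominatesᵇ g h)
  rungs = ⇔-sym (dominatesᵇ-⇔ le g h) ⇔-∘ (All-allFin-⇔ ⇔-∘
          All-map-⇔ (λ j → Fin-≤-⇔ (lookup-++ʳ g h j) (lookup-++ˡ g h (inject≤ j le))) (allFin n₁))
  to : All (NonIncreasingAlong f) (L₁ ++ L₂ ++ L₃) → T (ballotᵇ x x g h)
  to A with All.++⁻ L₁ A
  ... | A₁ , A₂₃ with All.++⁻ L₂ A₂₃
  ...   | A₂ , A₃ = Equivalence.from T-∧ (Equivalence.to path-g A₁ ,
                      Equivalence.from T-∧ (Equivalence.to path-h A₂ , Equivalence.to rungs A₃))
  from : T (ballotᵇ x x g h) → All (NonIncreasingAlong f) (L₁ ++ L₂ ++ L₃)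
  from t with Equivalence.to T-∧ t
  ... | t₁ , t₂₃ with Equivalence.to T-∧ t₂₃
  ...   | t₂ , t₃ = All.++⁺ (Equivalence.from path-g t₁) (All.++⁺ (Equivalence.from path-h t₂) (Equivalence.from rungs t₃))

σns≡ballotCount : ∀ {n₁ n₂} (le : n₁ ≤ n₂) x → σns (suc x) (𝔊 n₁ n₂ le) ≡ ballotCount (suc x) n₂ n₁ x x
σns≡ballotCount {n₁} {n₂} le x = begin
  σns (suc x) (𝔊 n₁ n₂ le)
    ≡⟨ length-filter≡∑ P? (allFuns (n₂ + n₁) (suc x)) ⟩
  ∑[ f ← allFuns (n₂ + n₁) (suc x) ] 𝟙 (does (P? f))
    ≡⟨ ∑-allFuns-++ n₂ n₁ (suc x) _ (λ f≗f′ → cong 𝟙 (does-⇔ (All-⇔ f≗f′) (P? _) (P? _))) ⟩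
  ∑[ g ← allFuns n₂ (suc x) ] ∑[ h ← allFuns n₁ (suc x) ] 𝟙 (does (P? (g VF.++ h)))
    ≡⟨ ∑-cong (allFuns n₂ (suc x)) (λ g → ∑-cong (allFuns n₁ (suc x)) (λ h →
         cong 𝟙 (does-⇔ (disposition-⇔ le g h) (P? _) (T? _)))) ⟩
  ballotCount (suc x) n₂ n₁ x x
    ∎
  where
  P? : (f : Fin (n₂ + n₁) → Fin (suc x)) → Dec (IsNonStrictDisposition (𝔊 n₁ n₂ le) (suc x) f)
  P? f = All.all? (λ a → f (proj₂ a) Fin.≤? f (proj₁ a)) (arcs (𝔊 n₁ n₂ le))
  All-⇔ : ∀ {f f′ : Fin (n₂ + n₁) → Fin (suc x)} → f ≗ f′ →
    IsNonStrictDisposition (𝔊 n₁ n₂ le) (suc x) f ⇔ IsNonStrictDisposition (𝔊 n₁ n₂ le) (suc x) f′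
  All-⇔ f≗f′ = mk⇔ (All.map (λ {a} → Equivalence.to (Fin-≤-⇔ (f≗f′ (proj₂ a)) (f≗f′ (proj₁ a)))))
                   (All.map (λ {a} → Equivalence.from (Fin-≤-⇔ (f≗f′ (proj₂ a)) (f≗f′ (proj₁ a)))))

-- Imported only now: the prefix operator +_ would make the ℕ sections (a +_) above ambiguous.
open import Data.Integer using (ℤ; +_)
import Data.Integer as ℤ
open import Data.Integer.Properties using (pos-*)
import Data.Integer.Tactic.RingSolver as ℤ-Solver
open import Data.Rational using (_/_; 1ℚ; toℚᵘ)
import Data.Rational as ℚ
open import Data.Rational.Properties using (toℚᵘ-injective; toℚᵘ-fromℚᵘ; toℚᵘ-homo-+; toℚᵘ-homo-*)
open import Data.Rational.Unnormalised using (mkℚᵘ; *≡*; 1ℚᵘ)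
import Data.Rational.Unnormalised as ℚᵘ
open import Data.Rational.Unnormalised.Properties using (+-cong; *-cong; ≃-refl; ≃-sym; ≃-trans)

toℚᵘ-/ : ∀ z k → toℚᵘ (z / suc k) ℚᵘ.≃ mkℚᵘ z k
toℚᵘ-/ z k = toℚᵘ-fromℚᵘ (mkℚᵘ z k)

mkℚᵘ-cross : ∀ (s c a b : ℤ) k → s ℤ.* + suc k ≡ (+ suc k ℤ.+ c) ℤ.* a ℤ.* b →
  mkℚᵘ s 0 ℚᵘ.≃ (1ℚᵘ ℚᵘ.+ mkℚᵘ c k) ℚᵘ.* mkℚᵘ a 0 ℚᵘ.* mkℚᵘ b 0
mkℚᵘ-cross s c a b k eq = *≡* (begin
  s ℤ.* + (1 * suc k * 1 * 1)                             ≡⟨ cong (λ d → s ℤ.* + d) denominator ⟩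
  s ℤ.* + suc k                                           ≡⟨ eq ⟩
  (+ suc k ℤ.+ c) ℤ.* a ℤ.* b                             ≡⟨ numerator (+ suc k) c a b ⟩
  ((+ 1 ℤ.* + suc k ℤ.+ c ℤ.* + 1) ℤ.* a ℤ.* b) ℤ.* + 1   ∎)
  where
  denominator : 1 * suc k * 1 * 1 ≡ suc k
  denominator = trans (*-identityʳ _) (trans (*-identityʳ _) (*-identityˡ (suc k)))
  numerator : ∀ K c a b → (K ℤ.+ c) ℤ.* a ℤ.* b ≡ ((+ 1 ℤ.* K ℤ.+ c ℤ.* + 1) ℤ.* a ℤ.* b) ℤ.* + 1
  numerator = ℤ-Solver.solve-∀

cross-multiply : ∀ (s c a b : ℤ) k → s ℤ.* + suc k ≡ (+ suc k ℤ.+ c) ℤ.* a ℤ.* b →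
  s / 1 ≡ (1ℚ ℚ.+ c / suc k) ℚ.* (a / 1) ℚ.* (b / 1)
cross-multiply s c a b k eq =
  toℚᵘ-injective (≃-trans (toℚᵘ-/ s 0) (≃-trans (mkℚᵘ-cross s c a b k eq) (≃-sym toℚᵘ-rhs)))
  where
  toℚᵘ-rhs : toℚᵘ ((1ℚ ℚ.+ c / suc k) ℚ.* (a / 1) ℚ.* (b / 1))
               ℚᵘ.≃ (1ℚᵘ ℚᵘ.+ mkℚᵘ c k) ℚᵘ.* mkℚᵘ a 0 ℚᵘ.* mkℚᵘ b 0
  toℚᵘ-rhs = ≃-trans (toℚᵘ-homo-* ((1ℚ ℚ.+ c / suc k) ℚ.* (a / 1)) (b / 1)) (*-cong
               (≃-trans (toℚᵘ-homo-* (1ℚ ℚ.+ c / suc k) (a / 1)) (*-cong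
                 (≃-trans (toℚᵘ-homo-+ 1ℚ (c / suc k)) (+-cong (≃-refl {1ℚᵘ}) (toℚᵘ-/ c k)))
                 (toℚᵘ-/ a 0)))
               (toℚᵘ-/ b 0))

cross-multiplied-formula : ∀ {σ A B} n₁ n₂ x E C′ →
  σ + E * C′ ≡ B * A → suc x * E ≡ n₁ * A → suc n₂ * C′ ≡ x * B →
  + σ ℤ.* + (suc n₂ * suc x) ≡ (+ (suc n₂ * suc x) ℤ.+ + n₁ ℤ.* (+ 1 ℤ.- + suc x)) ℤ.* + A ℤ.* + B
cross-multiplied-formula {σ} {A} {B} n₁ n₂ x E C′ total absorbE absorbC′ = begin
  + σ ℤ.* + (suc n₂ * suc x)
    ≡⟨ cong (+ σ ℤ.*_) (pos-* (suc n₂) (suc x)) ⟩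
  + σ ℤ.* (m ℤ.* i)
    ≡⟨ expand (+ σ) (+ E) (+ C′) m i ⟩
  (+ σ ℤ.+ + E ℤ.* + C′) ℤ.* (m ℤ.* i) ℤ.- (i ℤ.* + E) ℤ.* (m ℤ.* + C′)
    ≡⟨ cong₂ (λ u v → u ℤ.* (m ℤ.* i) ℤ.- v) cast-total
             (cong₂ ℤ._*_ (cast (suc x) E n₁ A absorbE) (cast (suc n₂) C′ x B absorbC′)) ⟩
  (+ B ℤ.* + A) ℤ.* (m ℤ.* i) ℤ.- (+ n₁ ℤ.* + A) ℤ.* (+ x ℤ.* + B)
    ≡⟨ collect (+ B) (+ A) m (+ n₁) (+ x) ⟩
  (m ℤ.* i ℤ.+ + n₁ ℤ.* (+ 1 ℤ.- + suc x)) ℤ.* + A ℤ.* + B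
    ≡⟨ cong (λ K → (K ℤ.+ + n₁ ℤ.* (+ 1 ℤ.- + suc x)) ℤ.* + A ℤ.* + B) (pos-* (suc n₂) (suc x)) ⟨
  (+ (suc n₂ * suc x) ℤ.+ + n₁ ℤ.* (+ 1 ℤ.- + suc x)) ℤ.* + A ℤ.* + B
    ∎
  where
  m i : ℤ
  m = + suc n₂
  i = + suc x
  cast-total : + σ ℤ.+ + E ℤ.* + C′ ≡ + B ℤ.* + A
  cast-total = trans (cong (λ z → + σ ℤ.+ z) (sym (pos-* E C′))) (trans (cong +_ total) (pos-* B A))
  cast : ∀ a b c d → a * b ≡ c * d → + a ℤ.* + b ≡ + c ℤ.* + d
  cast a b c d eq = trans (sym (pos-* a b)) (trans (cong +_ eq) (pos-* c d))
  expand : ∀ s e c m i → s ℤ.* (m ℤ.* i) ≡ (s ℤ.+ e ℤ.* c) ℤ.* (m ℤ.* i) ℤ.- (i ℤ.* e) ℤ.* (m ℤ.* c)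
  expand = ℤ-Solver.solve-∀
  collect : ∀ b a m n x → (b ℤ.* a) ℤ.* (m ℤ.* (+ 1 ℤ.+ x)) ℤ.- (n ℤ.* a) ℤ.* (x ℤ.* b)
                          ≡ (m ℤ.* (+ 1 ℤ.+ x) ℤ.+ n ℤ.* (+ 1 ℤ.- (+ 1 ℤ.+ x))) ℤ.* a ℤ.* b
  collect = ℤ-Solver.solve-∀

mainTheorem17 : (n₁ n₂ : ℕ) (le : n₁ ≤ n₂) (i : ℕ) .{{_ : NonZero i}} →
    (+ σns i (𝔊 n₁ n₂ le)) / 1
      ≡ (1ℚ ℚ.+ _/_ ((+ n₁) ℤ.* (+ 1 ℤ.- + i)) (suc n₂ * i) {{m*n≢0 (suc n₂) i}})
          ℚ.* ((+ ((i + n₁ ∸ 1) C n₁)) / 1)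
          ℚ.* ((+ ((i + n₂ ∸ 1) C n₂)) / 1)
mainTheorem17 n₁ n₂ le zero {{()}}
mainTheorem17 n₁ n₂ le (suc x) =
  cross-multiply (+ σ) (+ n₁ ℤ.* (+ 1 ℤ.- + suc x)) (+ A) (+ B) (x + n₂ * suc x)
                 (cross-multiplied-formula n₁ n₂ x E C′ total absorbE absorbC′)
  where
  σ A B E C′ : ℕ
  σ  = σns (suc x) (𝔊 n₁ n₂ le)
  A  = (x + n₁) C n₁
  B  = (x + n₂) C n₂
  E  = (x + n₁) C suc x
  C′ = (x + n₂) C suc n₂
  total : σ + E * C′ ≡ B * A
  total = subst (λ s → s + E * C′ ≡ B * A)
                (sym (trans (σns≡ballotCount le x) (ballotCount≡ballot le ≤-refl)))
                (ballot-formula le ≤-refl)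
  absorbE : suc x * E ≡ n₁ * A
  absorbE = subst (λ n → suc x * (n C suc x) ≡ n₁ * (n C n₁)) (+-comm n₁ x)
                  (trans (C-absorb x n₁) (cong (n₁ *_) (sym (C-sym n₁ x))))
  absorbC′ : suc n₂ * C′ ≡ x * B
  absorbC′ = C-absorb n₂ x
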